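{- Let $M$ be a monotone hypertriangle of order $n$. Let $i,k\in[n]$, $j\in[ik]$, and $m=M_{i,j,k}$. Then, whenever $i\le n-1$, \[M_{i+1,\,j+\max(0,m+k-n),\,k}\le M_{i,j,k}\le M_{i+1,\,j+\min(m-1,k),\,k},\] and, whenever $k\le n-1$, \[M_{i,\,j+\max(0,i+m-n),\,k+1}\le M_{i,j,k}\le M_{i,\,j+\min(i,m-1),\,k+1}.\]
   Context: A monotone hypertriangle of order $n$ is a family $M$ of finite weakly increasing sequences $M_{i,*,k}$ ("row $i$ of plane $k$"), $i,k\in[n]$, with entries in $[n]$, such that for all $i,j,k\in[n]$: (1) $M_{i,*,k}$ has $ik$ entries; (2) each $j\in[n]$ occurs between $\max(0,i+k-n)$ and $\min(i,k)$ times in $M_{i,*,k}$; (3) from one row to the next in plane $k$ (from $M_{i,*,k}$ to $M_{i+1,*,k}$), the increase in the number of entries $\le j$ is between $\max(0,j+k-n)$ and $\min(j,k)$; (4) from one plane to the next in row $i$ (from $M_{i,*,k}$ to $M_{i,*,k+1}$), the increase in the number of entries $\le j$ is between $\max(0,i+j-n)$ and $\min(i,j)$. $M_{i,j,k}$ denotes the $j$-th entry of $M_{i,*,k}$. -}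

module Defs where

open import Data.Nat using (ℕ; zero; suc; _+_; _*_; _∸_; _≤_; _⊓_; _≤?_; _≟_)
open import Data.List using (List; []; _∷_; length; filter)
open import Data.List.Relation.Unary.All using (All)
open import Data.List.Relation.Unary.Linked using (Linked)
open import Data.Product using (_×_)
open import Relation.Binary.PropositionalEquality using (_≡_)

cntLe : ℕ → List ℕ → ℕ
cntLe j l = length (filter (_≤? j) l)

occ : ℕ → List ℕ → ℕ
occ j l = length (filter (_≟ j) l)

-- l [ j ]≡ a : the j-th entry (1-based) of l exists and equals a
data _[_]≡_ : List ℕ → ℕ → ℕ → Set where
  here  : ∀ {x xs} → (x ∷ xs) [ 1 ]≡ x
  there : ∀ {x xs j a} → xs [ suc j ]≡ a → (x ∷ xs) [ suc (suc j) ]≡ a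

-- M i k is row i of plane k
-- (indices i, k ∈ [n] = {1,…,n}; values of M outside that range are irrelevant).
-- max(0, a + b - n) is written  a + b ∸ n , min as  _⊓_ .
record IsMonotoneHypertriangle (n : ℕ) (M : ℕ → ℕ → List ℕ) : Set where
  field
    increasing : ∀ i k → 1 ≤ i → i ≤ n → 1 ≤ k → k ≤ n → Linked _≤_ (M i k)
    inRange    : ∀ i k → 1 ≤ i → i ≤ n → 1 ≤ k → k ≤ n →
                 All (λ x → 1 ≤ x × x ≤ n) (M i k)
    len        : ∀ i k → 1 ≤ i → i ≤ n → 1 ≤ k → k ≤ n → length (M i k) ≡ i * k
    occLower   : ∀ i j k → 1 ≤ i → i ≤ n → 1 ≤ j → j ≤ n → 1 ≤ k → k ≤ n →
                 i + k ∸ n ≤ occ j (M i k)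
    occUpper   : ∀ i j k → 1 ≤ i → i ≤ n → 1 ≤ j → j ≤ n → 1 ≤ k → k ≤ n →
                 occ j (M i k) ≤ i ⊓ k
    -- (3) row i to row i+1 in plane k (i, i+1 ∈ [n])
    rowLower   : ∀ i j k → 1 ≤ i → i + 1 ≤ n → 1 ≤ j → j ≤ n → 1 ≤ k → k ≤ n →
                 cntLe j (M i k) + (j + k ∸ n) ≤ cntLe j (M (i + 1) k)
    rowUpper   : ∀ i j k → 1 ≤ i → i + 1 ≤ n → 1 ≤ j → j ≤ n → 1 ≤ k → k ≤ n →
                 cntLe j (M (i + 1) k) ≤ cntLe j (M i k) + (j ⊓ k)
    -- (4) plane k to plane k+1 in row i (k, k+1 ∈ [n])
    planeLower : ∀ i j k → 1 ≤ i → i ≤ n → 1 ≤ j → j ≤ n → 1 ≤ k → k + 1 ≤ n →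
                 cntLe j (M i k) + (i + j ∸ n) ≤ cntLe j (M i (k + 1))
    planeUpper : ∀ i j k → 1 ≤ i → i ≤ n → 1 ≤ j → j ≤ n → 1 ≤ k → k + 1 ≤ n →
                 cntLe j (M i (k + 1)) ≤ cntLe j (M i k) + (i ⊓ j)

module Submission where

-- In a weakly increasing list L the position j of an entry m is pinned down by the counts:
-- cntLe (m - 1) L < j ≤ cntLe m L, and conversely every position p with p ≤ cntLe x L
-- carries an entry ≤ x, every position p with cntLe x L < p carries an entry > x.
-- Axioms (3) and (4) bound how these counts change from one row (plane) to the next, so
-- shifting j by the lower (upper) bound of the increase lands on an entry ≤ m (≥ m).

open import Defs
open import Data.Nat using (ℕ; zero; suc; _+_; _*_; _∸_; _≤_; _<_; _≰_; _⊓_; z≤n; s≤s; s≤s⁻¹)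
open import Data.Nat.Properties
open import Data.List using (List; []; _∷_; length)
open import Data.List.Properties using (filter-accept; filter-reject; filter-none)
open import Data.List.Relation.Unary.All as All using (All; _∷_)
open import Data.List.Relation.Unary.Linked using (Linked; tail)
open import Data.List.Relation.Unary.Linked.Properties using (Linked⇒All)
open import Data.Product using (_×_; ∃-syntax; _,_; proj₁; proj₂)
open import Relation.Binary.PropositionalEquality using (_≡_; sym; cong; subst)
open import Relation.Nullary using (yes; no)
open import Data.Empty using (⊥-elim)

Sorted : List ℕ → Set
Sorted = Linked _≤_

head≤all : ∀ {x xs} → Sorted (x ∷ xs) → All (x ≤_) (x ∷ xs)
head≤all = Linked⇒All ≤-trans ≤-refl

lookup-All : ∀ {P : ℕ → Set} {L j a} → All P L → L [ j ]≡ a → P a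
lookup-All (p ∷ _)  here       = p
lookup-All (_ ∷ ps) (there ix) = lookup-All ps ix

cntLe-accept : ∀ {x y} ys → y ≤ x → cntLe x (y ∷ ys) ≡ suc (cntLe x ys)
cntLe-accept {x} _ y≤x = cong length (filter-accept (_≤? x) y≤x)

cntLe-reject : ∀ {x y} ys → y ≰ x → cntLe x (y ∷ ys) ≡ cntLe x ys
cntLe-reject {x} _ y≰x = cong length (filter-reject (_≤? x) y≰x)

cntLe-none : ∀ {x ys} → All (x <_) ys → cntLe x ys ≡ 0
cntLe-none {x} x<ys = cong length (filter-none (_≤? x) (All.map <⇒≱ x<ys))

cntLe-below-head : ∀ {x y ys} → x < y → Sorted (y ∷ ys) → cntLe x (y ∷ ys) ≡ 0
cntLe-below-head x<y s = cntLe-none (All.map (<-≤-trans x<y) (head≤all s))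

cntLe-∷-≤ : ∀ x y ys → cntLe x (y ∷ ys) ≤ suc (cntLe x ys)
cntLe-∷-≤ x y ys with y ≤? x
... | yes y≤x = ≤-reflexive (cntLe-accept ys y≤x)
... | no  y≰x = ≤-trans (≤-reflexive (cntLe-reject ys y≰x)) (n≤1+n _)

position≤cntLe : ∀ {L j m} → Sorted L → L [ j ]≡ m → j ≤ cntLe m L
position≤cntLe {m ∷ xs} _ here = subst (1 ≤_) (sym (cntLe-accept {m} xs ≤-refl)) (s≤s z≤n)
position≤cntLe {x ∷ xs} s (there ix) =
  subst (_ ≤_) (sym (cntLe-accept xs (lookup-All (head≤all s) (there ix))))
        (s≤s (position≤cntLe (tail s) ix))

cntLe<position : ∀ {L j m} x → x < m → Sorted L → L [ j ]≡ m → cntLe x L < j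
cntLe<position x x<m s here = s≤s (≤-reflexive (cntLe-below-head x<m s))
cntLe<position {y ∷ ys} x x<m s (there ix) =
  ≤-<-trans (cntLe-∷-≤ x y ys) (s≤s (cntLe<position x x<m (tail s) ix))

∃-lookup : ∀ {L p} → 1 ≤ p → p ≤ length L → ∃[ a ] L [ p ]≡ a
∃-lookup {x ∷ xs} {suc zero}    _ _         = x , here
∃-lookup {x ∷ xs} {suc (suc p)} _ (s≤s p≤∣xs∣) with ∃-lookup {xs} (s≤s z≤n) p≤∣xs∣
... | a , ix = a , there ix

lookup≤-within-cntLe : ∀ {L x p} → Sorted L → 1 ≤ p → p ≤ cntLe x L → ∃[ a ] (L [ p ]≡ a × a ≤ x)
lookup≤-within-cntLe {[]} _ 1≤p p≤0 = ⊥-elim (<⇒≱ 1≤p p≤0)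
lookup≤-within-cntLe {y ∷ ys} {x} s 1≤p p≤c with y ≤? x
... | no y≰x = ⊥-elim (<⇒≱ 1≤p (subst (_ ≤_) (cntLe-below-head (≰⇒> y≰x) s) p≤c))
lookup≤-within-cntLe {y ∷ ys} {x} {suc zero}    s _ _   | yes y≤x = y , here , y≤x
lookup≤-within-cntLe {y ∷ ys} {x} {suc (suc p)} s _ p≤c | yes y≤x
  with lookup≤-within-cntLe (tail s) (s≤s z≤n) (s≤s⁻¹ (subst (_ ≤_) (cntLe-accept ys y≤x) p≤c))
... | a , ix , a≤x = a , there ix , a≤x

lookup>-beyond-cntLe : ∀ {L x p} → Sorted L → cntLe x L < p → p ≤ length L → ∃[ b ] (L [ p ]≡ b × x < b)
lookup>-beyond-cntLe {[]} _ c<p p≤0 = ⊥-elim (<⇒≱ c<p p≤0)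
lookup>-beyond-cntLe {y ∷ ys} {x} s c<p p≤∣L∣ with y ≤? x
... | no y≰x with ∃-lookup (≤-trans (s≤s z≤n) c<p) p≤∣L∣
...   | b , ix = b , ix , lookup-All (All.map (<-≤-trans (≰⇒> y≰x)) (head≤all s)) ix
lookup>-beyond-cntLe {y ∷ ys} {x} {suc zero} s c<p _ | yes y≤x =
  ⊥-elim (<⇒≱ c<p (subst (1 ≤_) (sym (cntLe-accept ys y≤x)) (s≤s z≤n)))
lookup>-beyond-cntLe {y ∷ ys} {x} {suc (suc p)} s c<p (s≤s p≤∣ys∣) | yes y≤x
  with lookup>-beyond-cntLe (tail s) (s≤s⁻¹ (subst (_< suc (suc p)) (cntLe-accept ys y≤x) c<p)) p≤∣ys∣
... | b , ix , x<b = b , there ix , x<b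

shifted-lookup-≤ : ∀ {L L′ j m d} → Sorted L → Sorted L′ → L [ j ]≡ m → 1 ≤ j →
                   cntLe m L + d ≤ cntLe m L′ → ∃[ a ] (L′ [ j + d ]≡ a × a ≤ m)
shifted-lookup-≤ {j = j} {d = d} s s′ ix 1≤j growth =
  lookup≤-within-cntLe s′ (≤-trans 1≤j (m≤m+n j d))
                          (≤-trans (+-monoˡ-≤ d (position≤cntLe s ix)) growth)

shifted-lookup-≥ : ∀ {L L′ j m d} → Sorted L → Sorted L′ → L [ j ]≡ m → 1 ≤ m →
                   cntLe (m ∸ 1) L′ ≤ cntLe (m ∸ 1) L + d → j + d ≤ length L′ →
                   ∃[ b ] (L′ [ j + d ]≡ b × m ≤ b)
shifted-lookup-≥ {m = suc m} {d} s s′ ix _ growth room =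
  lookup>-beyond-cntLe s′ (≤-<-trans growth (+-monoˡ-< d (cntLe<position m ≤-refl s ix))) room

module _ {n : ℕ} {M : ℕ → ℕ → List ℕ} (H : IsMonotoneHypertriangle n M) where
  open IsMonotoneHypertriangle H

  cntLe-zero : ∀ {i k} → 1 ≤ i → i ≤ n → 1 ≤ k → k ≤ n → cntLe 0 (M i k) ≡ 0
  cntLe-zero 1≤i i≤n 1≤k k≤n = cntLe-none (All.map proj₁ (inRange _ _ 1≤i i≤n 1≤k k≤n))

  -- (3) and (4) are only required for j ≥ 1, but the upper bounds are needed at j = m - 1 = 0.
  rowUpper₀ : ∀ i j k → 1 ≤ i → i + 1 ≤ n → j ≤ n → 1 ≤ k → k ≤ n →
              cntLe j (M (i + 1) k) ≤ cntLe j (M i k) + (j ⊓ k)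
  rowUpper₀ i zero k 1≤i i+1≤n _ 1≤k k≤n =
    ≤-trans (≤-reflexive (cntLe-zero (≤-trans 1≤i (m≤m+n i 1)) i+1≤n 1≤k k≤n)) z≤n
  rowUpper₀ i (suc j) k 1≤i i+1≤n j≤n 1≤k k≤n = rowUpper i (suc j) k 1≤i i+1≤n (s≤s z≤n) j≤n 1≤k k≤n

  planeUpper₀ : ∀ i j k → 1 ≤ i → i ≤ n → j ≤ n → 1 ≤ k → k + 1 ≤ n →
                cntLe j (M i (k + 1)) ≤ cntLe j (M i k) + (i ⊓ j)
  planeUpper₀ i zero k 1≤i i≤n _ 1≤k k+1≤n =
    ≤-trans (≤-reflexive (cntLe-zero 1≤i i≤n (≤-trans 1≤k (m≤m+n k 1)) k+1≤n)) z≤n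
  planeUpper₀ i (suc j) k 1≤i i≤n j≤n 1≤k k+1≤n = planeUpper i (suc j) k 1≤i i≤n (s≤s z≤n) j≤n 1≤k k+1≤n

  entry-inRange : ∀ {i k j m} → 1 ≤ i → i ≤ n → 1 ≤ k → k ≤ n → M i k [ j ]≡ m → 1 ≤ m × m ≤ n
  entry-inRange 1≤i i≤n 1≤k k≤n = lookup-All (inRange _ _ 1≤i i≤n 1≤k k≤n)

  rowBounds : ∀ {i j k m} → 1 ≤ i → i + 1 ≤ n → 1 ≤ k → k ≤ n → 1 ≤ j → j ≤ i * k →
              M i k [ j ]≡ m →
              (∃[ a ] (M (i + 1) k [ j + (m + k ∸ n) ]≡ a × a ≤ m))
            × (∃[ b ] (M (i + 1) k [ j + ((m ∸ 1) ⊓ k) ]≡ b × m ≤ b))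
  rowBounds {i} {j} {k} {m} 1≤i i+1≤n 1≤k k≤n 1≤j j≤ik ix =
      shifted-lookup-≤ sorted sorted′ ix 1≤j (rowLower i m k 1≤i i+1≤n 1≤m m≤n 1≤k k≤n)
    , shifted-lookup-≥ sorted sorted′ ix 1≤m
        (rowUpper₀ i (m ∸ 1) k 1≤i i+1≤n (≤-trans (m∸n≤m m 1) m≤n) 1≤k k≤n) room
    where
    i≤n : i ≤ n
    i≤n = ≤-trans (m≤m+n i 1) i+1≤n
    1≤i+1 : 1 ≤ i + 1
    1≤i+1 = ≤-trans 1≤i (m≤m+n i 1)
    sorted : Sorted (M i k)
    sorted = increasing i k 1≤i i≤n 1≤k k≤n
    sorted′ : Sorted (M (i + 1) k)
    sorted′ = increasing (i + 1) k 1≤i+1 i+1≤n 1≤k k≤n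
    1≤m : 1 ≤ m
    1≤m = proj₁ (entry-inRange 1≤i i≤n 1≤k k≤n ix)
    m≤n : m ≤ n
    m≤n = proj₂ (entry-inRange 1≤i i≤n 1≤k k≤n ix)
    room : j + ((m ∸ 1) ⊓ k) ≤ length (M (i + 1) k)
    room = begin
      j + ((m ∸ 1) ⊓ k)     ≤⟨ +-mono-≤ j≤ik (m⊓n≤n (m ∸ 1) k) ⟩
      i * k + k             ≡⟨ +-comm (i * k) k ⟩
      suc i * k             ≡⟨ cong (_* k) (+-comm 1 i) ⟩
      (i + 1) * k           ≡⟨ sym (len (i + 1) k 1≤i+1 i+1≤n 1≤k k≤n) ⟩
      length (M (i + 1) k)  ∎
      where open ≤-Reasoning

  planeBounds : ∀ {i j k m} → 1 ≤ i → i ≤ n → 1 ≤ k → k + 1 ≤ n → 1 ≤ j → j ≤ i * k →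
                M i k [ j ]≡ m →
                (∃[ a ] (M i (k + 1) [ j + (i + m ∸ n) ]≡ a × a ≤ m))
              × (∃[ b ] (M i (k + 1) [ j + (i ⊓ (m ∸ 1)) ]≡ b × m ≤ b))
  planeBounds {i} {j} {k} {m} 1≤i i≤n 1≤k k+1≤n 1≤j j≤ik ix =
      shifted-lookup-≤ sorted sorted′ ix 1≤j (planeLower i m k 1≤i i≤n 1≤m m≤n 1≤k k+1≤n)
    , shifted-lookup-≥ sorted sorted′ ix 1≤m
        (planeUpper₀ i (m ∸ 1) k 1≤i i≤n (≤-trans (m∸n≤m m 1) m≤n) 1≤k k+1≤n) room
    where
    k≤n : k ≤ n
    k≤n = ≤-trans (m≤m+n k 1) k+1≤n
    1≤k+1 : 1 ≤ k + 1
    1≤k+1 = ≤-trans 1≤k (m≤m+n k 1)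
    sorted : Sorted (M i k)
    sorted = increasing i k 1≤i i≤n 1≤k k≤n
    sorted′ : Sorted (M i (k + 1))
    sorted′ = increasing i (k + 1) 1≤i i≤n 1≤k+1 k+1≤n
    1≤m : 1 ≤ m
    1≤m = proj₁ (entry-inRange 1≤i i≤n 1≤k k≤n ix)
    m≤n : m ≤ n
    m≤n = proj₂ (entry-inRange 1≤i i≤n 1≤k k≤n ix)
    room : j + (i ⊓ (m ∸ 1)) ≤ length (M i (k + 1))
    room = begin
      j + (i ⊓ (m ∸ 1))     ≤⟨ +-mono-≤ j≤ik (m⊓n≤m i (m ∸ 1)) ⟩
      i * k + i             ≡⟨ +-comm (i * k) i ⟩
      i + i * k             ≡⟨ sym (*-suc i k) ⟩
      i * suc k             ≡⟨ cong (i *_) (+-comm 1 k) ⟩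
      i * (k + 1)           ≡⟨ sym (len i (k + 1) 1≤i i≤n 1≤k+1 k+1≤n) ⟩
      length (M i (k + 1))  ∎
      where open ≤-Reasoning

mainTheorem20 : ∀ (n : ℕ) (M : ℕ → ℕ → List ℕ) → IsMonotoneHypertriangle n M →
    ∀ i j k m → 1 ≤ i → i ≤ n → 1 ≤ k → k ≤ n → 1 ≤ j → j ≤ i * k →
    M i k [ j ]≡ m →
    ((i + 1 ≤ n →
        (∃[ a ] (M (i + 1) k [ j + (m + k ∸ n) ]≡ a × a ≤ m))
      × (∃[ b ] (M (i + 1) k [ j + ((m ∸ 1) ⊓ k) ]≡ b × m ≤ b)))
    × (k + 1 ≤ n →
        (∃[ a ] (M i (k + 1) [ j + (i + m ∸ n) ]≡ a × a ≤ m))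
      × (∃[ b ] (M i (k + 1) [ j + (i ⊓ (m ∸ 1)) ]≡ b × m ≤ b))))
mainTheorem20 n M H i j k m 1≤i i≤n 1≤k k≤n 1≤j j≤ik ix =
    (λ i+1≤n → rowBounds H 1≤i i+1≤n 1≤k k≤n 1≤j j≤ik ix)
  , (λ k+1≤n → planeBounds H 1≤i i≤n 1≤k k+1≤n 1≤j j≤ik ix)
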